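{- Let $\mathbf{ILX}$ be a logic extending $\mathbf{IL}$ that contains every instance of $\mathsf W$: $A\rhd B\to A\rhd B\wedge\Box\neg A$. Let $\Gamma$ be an $\mathbf{ILX}$-MCS with $\neg(A\rhd B)\in\Gamma$. Then there exists an $\mathbf{ILX}$-MCS $\Delta$ with $\Gamma\prec_{\{\Box\neg A,\neg B\}}\Delta$ and $A\in\Delta$.
   Context: Formulas: $\bot$, propositional variables, $\to$, $\Box$, binary $\rhd$; $\Diamond A:=\neg\Box\neg A$. $\mathbf{IL}$: classical tautologies, K, L: $\Box(\Box A\to A)\to\Box A$, J1: $\Box(A\to B)\to A\rhd B$, J2: $(A\rhd B)\wedge(B\rhd C)\to A\rhd C$, J3: $(A\rhd C)\wedge(B\rhd C)\to A\vee B\rhd C$, J4: $A\rhd B\to(\Diamond A\to\Diamond B)$, J5: $\Diamond A\rhd A$; rules modus ponens and necessitation. An $\mathbf{ILX}$-MCS is a maximal $\mathbf{ILX}$-consistent set. $\Gamma\prec_S\Delta$ iff for every formula $A$ and finite $S'\subseteq S$, $\neg A\rhd\bigvee_{\sigma\in S'}\neg\sigma\in\Gamma$ implies $A,\Box A\in\Delta$ (empty disjunction is $\bot$). -}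

module Defs where

open import Data.Nat using (ℕ)
open import Data.Bool using (Bool; true; false; not; _∨_)
open import Data.List using (List; []; _∷_; foldr)
open import Data.List.Relation.Unary.All using (All)
open import Data.Product using (Σ; _×_)
open import Data.Sum using (_⊎_)
open import Relation.Binary.PropositionalEquality using (_≡_)
open import Relation.Nullary using (¬_)

data Fm : Set where
  ⊥'   : Fm
  var  : ℕ → Fm
  _⇒_  : Fm → Fm → Fm
  □    : Fm → Fm
  _▷_  : Fm → Fm → Fm

infixr 5 _⇒_
infix 6 _▷_

~_ : Fm → Fm
~ A = A ⇒ ⊥'

⊤' : Fm
⊤' = ~ ⊥'

_∨'_ : Fm → Fm → Fm
A ∨' B = (~ A) ⇒ B

_∧'_ : Fm → Fm → Fm
A ∧' B = ~ (A ⇒ ~ B)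

◇ : Fm → Fm
◇ A = ~ □ (~ A)

-- Classical tautologies: true under every Boolean valuation of the
-- propositionally atomic formulas (variables, □-formulas, ▷-formulas).
eval : (Fm → Bool) → Fm → Bool
eval v ⊥'      = false
eval v (A ⇒ B) = not (eval v A) ∨ eval v B
eval v (var n) = v (var n)
eval v (□ A)   = v (□ A)
eval v (A ▷ B) = v (A ▷ B)

Tautology : Fm → Set
Tautology A = (v : Fm → Bool) → eval v A ≡ true

-- Derivability in IL extended by an extra axiom set X (the logic ILX
-- is the closure of IL ∪ X under modus ponens and necessitation; every
-- logic extending IL closed under MP and Nec arises this way).
data _⊢_ (X : Fm → Set) : Fm → Set where
  taut : ∀ {A} → Tautology A → X ⊢ A
  axK  : ∀ {A B} → X ⊢ (□ (A ⇒ B) ⇒ □ A ⇒ □ B)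
  axL  : ∀ {A} → X ⊢ (□ (□ A ⇒ A) ⇒ □ A)
  axJ1 : ∀ {A B} → X ⊢ (□ (A ⇒ B) ⇒ A ▷ B)
  axJ2 : ∀ {A B C} → X ⊢ (((A ▷ B) ∧' (B ▷ C)) ⇒ A ▷ C)
  axJ3 : ∀ {A B C} → X ⊢ (((A ▷ C) ∧' (B ▷ C)) ⇒ (A ∨' B) ▷ C)
  axJ4 : ∀ {A B} → X ⊢ ((A ▷ B) ⇒ (◇ A ⇒ ◇ B))
  axJ5 : ∀ {A} → X ⊢ (◇ A ▷ A)
  ext  : ∀ {A} → X A → X ⊢ A
  mp   : ∀ {A B} → X ⊢ (A ⇒ B) → X ⊢ A → X ⊢ B
  nec  : ∀ {A} → X ⊢ A → X ⊢ □ A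

FmSet : Set₁
FmSet = Fm → Set

⋀ : List Fm → Fm
⋀ = foldr _∧'_ ⊤'

⋁ : List Fm → Fm
⋁ = foldr _∨'_ ⊥'

Consistent : (X : Fm → Set) → FmSet → Set
Consistent X Γ = ¬ (Σ (List Fm) λ l → All Γ l × (X ⊢ (⋀ l ⇒ ⊥')))

_⊆_ : FmSet → FmSet → Set
Γ ⊆ Δ = ∀ A → Γ A → Δ A

MCS : (X : Fm → Set) → FmSet → Set₁
MCS X Γ = Consistent X Γ × ((Δ : FmSet) → Γ ⊆ Δ → Consistent X Δ → Δ ⊆ Γ)

Prec : FmSet → FmSet → FmSet → Set
Prec S Γ Δ = (A : Fm) (S' : List Fm) → All S S' →
             Γ ((~ A) ▷ ⋁ (Data.List.map ~_ S')) → Δ A × Δ (□ A)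

Pair : Fm → Fm → FmSet
Pair C D σ = (σ ≡ C) ⊎ (σ ≡ D)

W : Fm → Fm → Fm
W A B = (A ▷ B) ⇒ (A ▷ (B ∧' □ (~ A)))

module Submission where

-- Put E := ◇A ∨ B and let Δ₀ consist of A together with C and □C for every
-- C such that ¬C ▷ ⋁{¬σ | σ ∈ S'} ∈ Γ for a finite S' ⊆ {□¬A, ¬B}.  Any
-- MCS extending Δ₀ is the required Δ, so it suffices to show that Δ₀ is
-- consistent and to extend it by Lindenbaum's lemma.  Each x ∈ Δ₀ satisfies
-- (A ∧ ¬x) ▷ E ∈ Γ (for □C via J5), hence by J3 so does every finite
-- conjunction of members of Δ₀.  If Δ₀ derived ⊥ we would get A ▷ E ∈ Γ,
-- hence A ▷ E ∧ □¬A ∈ Γ by W, hence A ▷ B ∈ Γ, contradicting ¬(A ▷ B) ∈ Γ.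

open import Defs
open import Data.Bool using (Bool; true; false; not; _∨_)
open import Data.Empty using (⊥; ⊥-elim)
open import Data.List using (List; []; _∷_; _++_; map)
open import Data.List.Relation.Unary.All using (All; []; _∷_)
import Data.List.Relation.Unary.All as All
open import Data.List.Relation.Unary.All.Properties using (++⁺)
open import Data.Nat using (ℕ; zero; suc; _+_; _≤′_; ≤′-refl; ≤′-step)
open import Data.Nat.Properties using (≤⇒≤′; m≤m+n; m≤n+m)
open import Data.Nat.Binary using (ℕᵇ; 2[1+_]; 1+[2_]; toℕ)
open import Data.Nat.Binary.Properties using (toℕ-injective)
open import Data.Product using (Σ; _×_; _,_; proj₁; proj₂)
open import Data.Sum using (_⊎_; inj₁; inj₂)
open import Relation.Binary.PropositionalEquality using (_≡_; refl; sym; trans)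
open import Relation.Nullary using (¬_)

-- Truth of a formula under a Boolean valuation.  The record wrapper lets
-- Agda recover the valuation and the formula from the type.
record Holds (v : Fm → Bool) (P : Fm) : Set where
  constructor holds
  field truth : eval v P ≡ true
open Holds

module _ {v : Fm → Bool} where

  ⊥-fails : ¬ Holds v ⊥'
  ⊥-fails (holds ())

  ⇒-intro : ∀ {P Q} → (Holds v P → Holds v Q) → Holds v (P ⇒ Q)
  ⇒-intro {P} {Q} f = holds (by-value (eval v P) refl)
    where
    by-value : (b : Bool) → eval v P ≡ b → not b ∨ eval v Q ≡ true
    by-value true  p = truth (f (holds p))
    by-value false _ = refl

  ⇒-elim : ∀ {P Q} → Holds v (P ⇒ Q) → Holds v P → Holds v Q
  ⇒-elim {P} {Q} (holds h) (holds p) = holds (modus-ponens p h)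
    where
    modus-ponens : ∀ {b} → b ≡ true → not b ∨ eval v Q ≡ true → eval v Q ≡ true
    modus-ponens refl q = q

  decide : ∀ P → Holds v P ⊎ ¬ Holds v P
  decide P = by-value (eval v P) refl
    where
    by-value : (b : Bool) → eval v P ≡ b → Holds v P ⊎ ¬ Holds v P
    by-value true  p = inj₁ (holds p)
    by-value false p = inj₂ λ h → true≢false (trans (sym (truth h)) p)
      where
      true≢false : ¬ (true ≡ false)
      true≢false ()

  stable : ∀ {P} → ¬ ¬ Holds v P → Holds v P
  stable {P} nnp with decide P
  ... | inj₁ p  = p
  ... | inj₂ np = ⊥-elim (nnp np)

  ~-intro : ∀ {P} → ¬ Holds v P → Holds v (~ P)
  ~-intro np = ⇒-intro λ p → ⊥-elim (np p)

  ~-elim : ∀ {P} → Holds v (~ P) → ¬ Holds v P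
  ~-elim n p = ⊥-fails (⇒-elim n p)

  ~~-elim : ∀ {P} → Holds v (~ ~ P) → Holds v P
  ~~-elim nn = stable λ np → ~-elim nn (~-intro np)

  ∧-intro : ∀ {P Q} → Holds v P → Holds v Q → Holds v (P ∧' Q)
  ∧-intro p q = ~-intro λ p⇒¬q → ~-elim (⇒-elim p⇒¬q p) q

  ∧-elimˡ : ∀ {P Q} → Holds v (P ∧' Q) → Holds v P
  ∧-elimˡ h = stable λ np → ~-elim h (⇒-intro λ p → ⊥-elim (np p))

  ∧-elimʳ : ∀ {P Q} → Holds v (P ∧' Q) → Holds v Q
  ∧-elimʳ h = stable λ nq → ~-elim h (⇒-intro λ _ → ~-intro nq)

  ∨-introˡ : ∀ {P Q} → Holds v P → Holds v (P ∨' Q)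
  ∨-introˡ p = ⇒-intro λ np → ⊥-elim (~-elim np p)

  ∨-introʳ : ∀ {P Q} → Holds v Q → Holds v (P ∨' Q)
  ∨-introʳ q = ⇒-intro λ _ → q

  ∨-elim : ∀ {P Q} → Holds v (P ∨' Q) → Holds v P ⊎ Holds v Q
  ∨-elim {P} h with decide P
  ... | inj₁ p  = inj₁ p
  ... | inj₂ np = inj₂ (⇒-elim h (~-intro np))

  ⋀-++ : ∀ l₁ {l₂} → Holds v (⋀ (l₁ ++ l₂)) → Holds v (⋀ l₁) × Holds v (⋀ l₂)
  ⋀-++ []       h = holds refl , h
  ⋀-++ (x ∷ l₁) h =
    let (h₁ , h₂) = ⋀-++ l₁ (∧-elimʳ h) in ∧-intro (∧-elimˡ h) h₁ , h₂

module _ {X : Fm → Set} where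

  tautology : ∀ {P Q} → (∀ v → Holds v P → Holds v Q) → X ⊢ (P ⇒ Q)
  tautology f = taut λ v → truth (⇒-intro (f v))

  by-tautology : ∀ {P Q} → (∀ v → Holds v P → Holds v Q) → X ⊢ P → X ⊢ Q
  by-tautology f = mp (tautology f)

  by-tautology₂ : ∀ {P Q R} → (∀ v → Holds v P → Holds v Q → Holds v R) →
                  X ⊢ P → X ⊢ Q → X ⊢ R
  by-tautology₂ f d e = mp (mp (tautology λ v p → ⇒-intro (f v p)) d) e

  consistent-⊆ : ∀ {Δ₁ Δ₂} → Δ₁ ⊆ Δ₂ → Consistent X Δ₂ → Consistent X Δ₁
  consistent-⊆ Δ₁⊆Δ₂ c (l , l⊆Δ₁ , d) = c (l , All.map (Δ₁⊆Δ₂ _) l⊆Δ₁ , d)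

module Closure {X : Fm → Set} {Γ : FmSet} (Γ-mcs : MCS X Γ) where

  Cn : FmSet
  Cn φ = Σ (List Fm) λ l → All Γ l × X ⊢ (⋀ l ⇒ φ)

  Cn-⋀ : ∀ k → All Cn k → Cn (⋀ k)
  Cn-⋀ []      []                     = [] , [] , tautology λ _ t → t
  Cn-⋀ (φ ∷ k) ((l₁ , a₁ , d₁) ∷ cs) =
    let (l₂ , a₂ , d₂) = Cn-⋀ k cs in
    l₁ ++ l₂ , ++⁺ a₁ a₂ ,
    by-tautology₂ (λ _ h₁ h₂ → ⇒-intro λ h →
                    let (g₁ , g₂) = ⋀-++ l₁ h in
                    ∧-intro (⇒-elim h₁ g₁) (⇒-elim h₂ g₂))
                  d₁ d₂

  Cn-consistent : Consistent X Cn
  Cn-consistent (k , k⊆Cn , ⋀k⇒⊥) =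
    let (l , l⊆Γ , ⋀l⇒⋀k) = Cn-⋀ k k⊆Cn in
    proj₁ Γ-mcs (l , l⊆Γ ,
      by-tautology₂ (λ _ f g → ⇒-intro λ h → ⇒-elim g (⇒-elim f h)) ⋀l⇒⋀k ⋀k⇒⊥)

  -- Γ is deductively closed, since Cn is a consistent superset of Γ
  closed : ∀ {φ} l → All Γ l → X ⊢ (⋀ l ⇒ φ) → Γ φ
  closed l l⊆Γ d = proj₂ Γ-mcs Cn Γ⊆Cn Cn-consistent _ (l , l⊆Γ , d)
    where
    Γ⊆Cn : Γ ⊆ Cn
    Γ⊆Cn φ h = φ ∷ [] , h ∷ [] , tautology λ _ → ∧-elimˡ

  theorem : ∀ {φ} → X ⊢ φ → Γ φ
  theorem d = closed [] [] (by-tautology (λ _ t → ⇒-intro λ _ → t) d)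

  mp₁ : ∀ {φ ψ} → X ⊢ (φ ⇒ ψ) → Γ φ → Γ ψ
  mp₁ d h = closed (_ ∷ []) (h ∷ [])
    (by-tautology (λ _ f → ⇒-intro λ g → ⇒-elim f (∧-elimˡ g)) d)

  mp₂ : ∀ {φ ψ χ} → X ⊢ (φ ∧' ψ ⇒ χ) → Γ φ → Γ ψ → Γ χ
  mp₂ d h k = closed (_ ∷ _ ∷ []) (h ∷ k ∷ [])
    (by-tautology (λ _ f → ⇒-intro λ g →
                    ⇒-elim f (∧-intro (∧-elimˡ g) (∧-elimˡ (∧-elimʳ g)))) d)

  not-both : ∀ {φ} → Γ φ → Γ (~ φ) → ⊥
  not-both h n = proj₁ Γ-mcs (_ ∷ _ ∷ [] , h ∷ n ∷ [] ,
    tautology λ _ g → ⊥-elim (~-elim (∧-elimˡ (∧-elimʳ g)) (∧-elimˡ g)))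

  ▷-trans : ∀ {P Q R} → Γ (P ▷ Q) → Γ (Q ▷ R) → Γ (P ▷ R)
  ▷-trans = mp₂ axJ2

  ▷-join : ∀ {P Q R} → Γ (P ▷ R) → Γ (Q ▷ R) → Γ (P ∨' Q ▷ R)
  ▷-join = mp₂ axJ3

  ⇒-▷ : ∀ {P Q} → X ⊢ (P ⇒ Q) → Γ (P ▷ Q)
  ⇒-▷ d = theorem (mp axJ1 (nec d))

  ▷-left : ∀ {P Q R} → X ⊢ (Q ⇒ P) → Γ (P ▷ R) → Γ (Q ▷ R)
  ▷-left d = ▷-trans (⇒-▷ d)

  ▷-right : ∀ {P Q R} → X ⊢ (Q ⇒ R) → Γ (P ▷ Q) → Γ (P ▷ R)
  ▷-right d h = ▷-trans h (⇒-▷ d)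

  -- whatever ¬C interprets, ¬□C interprets too: ¬□C → ◇¬C and ◇¬C ▷ ¬C (J5)
  ¬□-▷ : ∀ {C R} → Γ (~ C ▷ R) → Γ (~ □ C ▷ R)
  ¬□-▷ {C} h = ▷-left ¬□⇒◇¬ (▷-trans (theorem axJ5) h)
    where
    ¬□⇒◇¬ : X ⊢ (~ □ C ⇒ ◇ (~ C))
    ¬□⇒◇¬ = by-tautology (λ _ k → ⇒-intro λ n → ~-intro λ b → ~-elim n (⇒-elim k b))
                         (mp axK (nec (tautology λ _ → ~~-elim)))

  -- if P ∧ ¬x interprets R for each x ∈ m, so does P ∧ ¬⋀m: it implies
  -- the disjunction of those formulas, which interprets R by J3
  ▷-⋀ : ∀ {P R} m → All (λ x → Γ ((P ∧' (~ x)) ▷ R)) m → Γ ((P ∧' (~ ⋀ m)) ▷ R)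
  ▷-⋀ []      []        = ⇒-▷ (tautology λ _ h → ⊥-elim (~-elim (∧-elimʳ h) (holds refl)))
  ▷-⋀ {P} (x ∷ m) (hx ∷ hm) = ▷-left split (▷-join hx (▷-⋀ m hm))
    where
    split : X ⊢ ((P ∧' (~ ⋀ (x ∷ m))) ⇒ ((P ∧' (~ x)) ∨' (P ∧' (~ ⋀ m))))
    split = tautology λ _ h → ⇒-intro λ n →
      let p = ∧-elimˡ h in
      ∧-intro p (~-intro λ t → ~-elim (∧-elimʳ h)
        (∧-intro (stable λ nx → ~-elim n (∧-intro p (~-intro nx))) t))

-- An injective coding of formulas by natural numbers, through a prefix-free
-- binary code: encode A k writes the code of A in front of the rest k.
private
  bit₀ bit₁ : ℕᵇ → ℕᵇ
  bit₀ = 1+[2_]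
  bit₁ = 2[1+_]

  bit₀-injective : ∀ {x y} → bit₀ x ≡ bit₀ y → x ≡ y
  bit₀-injective refl = refl

  bit₁-injective : ∀ {x y} → bit₁ x ≡ bit₁ y → x ≡ y
  bit₁-injective refl = refl

  unary : ℕ → ℕᵇ → ℕᵇ
  unary zero    k = bit₀ k
  unary (suc n) k = bit₁ (unary n k)

  encode : Fm → ℕᵇ → ℕᵇ
  encode ⊥'      k = bit₀ (bit₀ k)
  encode (var n) k = bit₀ (bit₁ (unary n k))
  encode (P ⇒ Q) k = bit₁ (bit₀ (bit₀ (encode P (encode Q k))))
  encode (□ P)   k = bit₁ (bit₁ (encode P k))
  encode (P ▷ Q) k = bit₁ (bit₀ (bit₁ (encode P (encode Q k))))

  unary-injective : ∀ m n {k l} → unary m k ≡ unary n l → m ≡ n × k ≡ l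
  unary-injective zero    zero    refl = refl , refl
  unary-injective (suc m) (suc n) eq with unary-injective m n (bit₁-injective eq)
  ... | refl , refl = refl , refl
  unary-injective zero    (suc n) ()
  unary-injective (suc m) zero    ()

  encode-injective : ∀ P Q {k l} → encode P k ≡ encode Q l → P ≡ Q × k ≡ l
  encode-injective ⊥' ⊥' refl = refl , refl
  encode-injective (var m) (var n) eq
    with unary-injective m n (bit₁-injective (bit₀-injective eq))
  ... | refl , refl = refl , refl
  encode-injective (P ⇒ Q) (P' ⇒ Q') eq
    with encode-injective P P' (bit₀-injective (bit₀-injective (bit₁-injective eq)))
  ... | refl , eq' with encode-injective Q Q' eq'
  ... | refl , refl = refl , refl
  encode-injective (□ P) (□ P') eq with encode-injective P P' (bit₁-injective (bit₁-injective eq))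
  ... | refl , refl = refl , refl
  encode-injective (P ▷ Q) (P' ▷ Q') eq
    with encode-injective P P' (bit₁-injective (bit₀-injective (bit₁-injective eq)))
  ... | refl , eq' with encode-injective Q Q' eq'
  ... | refl , refl = refl , refl
  encode-injective ⊥'      (var _)   ()
  encode-injective ⊥'      (_ ⇒ _)   ()
  encode-injective ⊥'      (□ _)     ()
  encode-injective ⊥'      (_ ▷ _)   ()
  encode-injective (var _) ⊥'        ()
  encode-injective (var _) (_ ⇒ _)   ()
  encode-injective (var _) (□ _)     ()
  encode-injective (var _) (_ ▷ _)   ()
  encode-injective (_ ⇒ _) ⊥'        ()
  encode-injective (_ ⇒ _) (var _)   ()
  encode-injective (_ ⇒ _) (□ _)     ()
  encode-injective (_ ⇒ _) (_ ▷ _)   ()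
  encode-injective (□ _)   ⊥'        ()
  encode-injective (□ _)   (var _)   ()
  encode-injective (□ _)   (_ ⇒ _)   ()
  encode-injective (□ _)   (_ ▷ _)   ()
  encode-injective (_ ▷ _) ⊥'        ()
  encode-injective (_ ▷ _) (var _)   ()
  encode-injective (_ ▷ _) (_ ⇒ _)   ()
  encode-injective (_ ▷ _) (□ _)     ()

code : Fm → ℕ
code P = toℕ (encode P ℕᵇ.zero)

code-injective : ∀ {P Q} → code P ≡ code Q → P ≡ Q
code-injective {P} {Q} eq = proj₁ (encode-injective P Q (toℕ-injective eq))

module Lindenbaum {X : Fm → Set} {Δ₀ : FmSet} (Δ₀-consistent : Consistent X Δ₀) where

  _∪｛_｝ : FmSet → Fm → FmSet
  (Θ ∪｛ x ｝) y = Θ y ⊎ y ≡ x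

  stage : ℕ → FmSet
  stage zero    x = Δ₀ x
  stage (suc n) x = stage n x ⊎ (code x ≡ n × Consistent X (stage n ∪｛ x ｝))

  stage-suc-part : ∀ n l → All (stage (suc n)) l →
    All (stage n) l ⊎ Σ Fm λ y → Consistent X (stage n ∪｛ y ｝) × All (stage n ∪｛ y ｝) l
  stage-suc-part n []      [] = inj₁ []
  stage-suc-part n (x ∷ l) (inj₁ s ∷ ss) with stage-suc-part n l ss
  ... | inj₁ ss'           = inj₁ (s ∷ ss')
  ... | inj₂ (y , c , ss') = inj₂ (y , c , inj₁ s ∷ ss')
  stage-suc-part n (x ∷ l) (inj₂ (cx , c) ∷ ss) = inj₂ (x , c , inj₂ refl ∷ All.map only-x ss)
    where
    only-x : ∀ {z} → stage (suc n) z → (stage n ∪｛ x ｝) z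
    only-x (inj₁ s)        = inj₁ s
    only-x (inj₂ (cz , _)) = inj₂ (code-injective (trans cz (sym cx)))

  stage-consistent : ∀ n → Consistent X (stage n)
  stage-consistent zero = Δ₀-consistent
  stage-consistent (suc n) (l , l⊆ , d) with stage-suc-part n l l⊆
  ... | inj₁ l⊆stage   = stage-consistent n (l , l⊆stage , d)
  ... | inj₂ (_ , c , l⊆ext) = c (l , l⊆ext , d)

  stage-mono : ∀ {m n x} → m ≤′ n → stage m x → stage n x
  stage-mono ≤′-refl     s = s
  stage-mono (≤′-step p) s = inj₁ (stage-mono p s)

  Δ : FmSet
  Δ x = Σ ℕ λ n → stage n x

  finite-in-stage : ∀ l → All Δ l → Σ ℕ λ n → All (stage n) l
  finite-in-stage []      []             = 0 , []
  finite-in-stage (x ∷ l) ((i , s) ∷ ss) =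
    let (n , ss') = finite-in-stage l ss in
    i + n , stage-mono (≤⇒≤′ (m≤m+n i n)) s
          ∷ All.map (stage-mono (≤⇒≤′ (m≤n+m n i))) ss'

  Δ-consistent : Consistent X Δ
  Δ-consistent (l , l⊆Δ , d) =
    let (n , l⊆stage) = finite-in-stage l l⊆Δ in stage-consistent n (l , l⊆stage , d)

  -- a formula of a consistent superset of Δ was admitted at its own stage
  Δ-maximal : (Δ' : FmSet) → Δ ⊆ Δ' → Consistent X Δ' → Δ' ⊆ Δ
  Δ-maximal Δ' Δ⊆Δ' c' x x∈Δ' = suc (code x) , inj₂ (refl , consistent-⊆ ext⊆Δ' c')
    where
    ext⊆Δ' : (stage (code x) ∪｛ x ｝) ⊆ Δ'
    ext⊆Δ' y (inj₁ s)    = Δ⊆Δ' y (code x , s)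
    ext⊆Δ' y (inj₂ refl) = x∈Δ'

  lindenbaum : Σ FmSet λ Δ → MCS X Δ × Δ₀ ⊆ Δ
  lindenbaum = Δ , (Δ-consistent , Δ-maximal) , λ x s → 0 , s

module Seed (X : Fm → Set) (W-axiom : ∀ A B → X ⊢ W A B)
            {Γ : FmSet} (Γ-mcs : MCS X Γ) (A B : Fm) (A⋫B : Γ (~ (A ▷ B))) where
  open Closure Γ-mcs

  S : FmSet
  S = Pair (□ (~ A)) (~ B)

  -- every member of Δ₀ fails only in ways interpreting E
  E : Fm
  E = ◇ A ∨' B

  ⋁¬S⇒E : ∀ {v} S' → All S S' → Holds v (⋁ (map ~_ S')) → Holds v E
  ⋁¬S⇒E []       []            h = ⊥-elim (⊥-fails h)
  ⋁¬S⇒E (σ ∷ S') (σ∈S ∷ S'⊆S) h with ∨-elim h | σ∈S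
  ... | inj₁ ¬σ | inj₁ refl = ∨-introˡ ¬σ
  ... | inj₁ ¬σ | inj₂ refl = ∨-introʳ (~~-elim ¬σ)
  ... | inj₂ h' | _         = ⋁¬S⇒E S' S'⊆S h'

  Required : Fm → Set
  Required C = Σ (List Fm) λ S' → All S S' × Γ (~ C ▷ ⋁ (map ~_ S'))

  Δ₀ : FmSet
  Δ₀ x = x ≡ A ⊎ Σ Fm λ C → Required C × (x ≡ C ⊎ x ≡ □ C)

  required-▷E : ∀ {C} → Required C → Γ (~ C ▷ E)
  required-▷E (S' , S'⊆S , h) = ▷-right (tautology λ _ → ⋁¬S⇒E S' S'⊆S) h

  Δ₀-▷E : ∀ {x} → Δ₀ x → Γ ((A ∧' (~ x)) ▷ E)
  Δ₀-▷E (inj₁ refl) = ⇒-▷ (tautology λ _ h → ⊥-elim (~-elim (∧-elimʳ h) (∧-elimˡ h)))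
  Δ₀-▷E (inj₂ (C , r , inj₁ refl)) = ▷-left (tautology λ _ → ∧-elimʳ) (required-▷E r)
  Δ₀-▷E (inj₂ (C , r , inj₂ refl)) = ▷-left (tautology λ _ → ∧-elimʳ) (¬□-▷ (required-▷E r))

  -- an inconsistency m ⊆ Δ₀ would yield A ▷ E, hence (by W) A ▷ B, in Γ
  Δ₀-consistent : Consistent X Δ₀
  Δ₀-consistent (m , m⊆Δ₀ , ⋀m⇒⊥) = not-both A▷B A⋫B
    where
    A⇒A∧¬⋀m : X ⊢ (A ⇒ (A ∧' (~ ⋀ m)))
    A⇒A∧¬⋀m = by-tautology (λ _ f → ⇒-intro λ a → ∧-intro a (~-intro λ t → ⊥-fails (⇒-elim f t)))
                           ⋀m⇒⊥

    E∧□¬A⇒B : X ⊢ ((E ∧' □ (~ A)) ⇒ B)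
    E∧□¬A⇒B = tautology λ _ h → ⇒-elim (∧-elimˡ h) (~-intro λ ◇A → ~-elim ◇A (∧-elimʳ h))

    A▷E : Γ (A ▷ E)
    A▷E = ▷-left A⇒A∧¬⋀m (▷-⋀ m (All.map Δ₀-▷E m⊆Δ₀))

    A▷B : Γ (A ▷ B)
    A▷B = ▷-right E∧□¬A⇒B (mp₁ (W-axiom A E) A▷E)

lemma6p7 : (X : Fm → Set) → (∀ A B → X ⊢ W A B) →
           (Γ : FmSet) → MCS X Γ → (A B : Fm) → Γ (~ (A ▷ B)) →
           Σ FmSet λ Δ → MCS X Δ × Prec (Pair (□ (~ A)) (~ B)) Γ Δ × Δ A
lemma6p7 X W-axiom Γ Γ-mcs A B A⋫B = Δ , Δ-mcs , Γ≺Δ , Δ₀⊆Δ A (inj₁ refl)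
  where
  open Seed X W-axiom Γ-mcs A B A⋫B
  open Lindenbaum Δ₀-consistent using (lindenbaum)

  Δ : FmSet
  Δ = proj₁ lindenbaum

  Δ-mcs : MCS X Δ
  Δ-mcs = proj₁ (proj₂ lindenbaum)

  Δ₀⊆Δ : Δ₀ ⊆ Δ
  Δ₀⊆Δ = proj₂ (proj₂ lindenbaum)

  Γ≺Δ : Prec S Γ Δ
  Γ≺Δ C S' S'⊆S h = Δ₀⊆Δ C (inj₂ (C , (S' , S'⊆S , h) , inj₁ refl))
                  , Δ₀⊆Δ (□ C) (inj₂ (C , (S' , S'⊆S , h) , inj₂ refl))
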